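{- Let $\Sigma$ be a first order signature, let $M$ be a first order model over it and let $(M, \mathcal L)$ be the least general model over it. Then, for all teams $X \in \mathcal L$ and all formulas $\phi$ with signature $\Sigma$ and with free variables in $\mathrm{Dom}(X)$, \[ (M, \mathcal L) \models_X \phi \Leftrightarrow (M, \mathcal G) \models_X \phi \mbox{ for all general models } (M, \mathcal G) \mbox{ over } M. \]
   Context: A general model $(M,\mathcal G)$ is a structure $M$ with a set $\mathcal G$ of teams. Teams are sets of assignments with a common finite domain. $\mathcal G$ must contain $\|\phi(\bar x,\bar m,\bar R)\|_M=\{s:\mathrm{Dom}(s)=\bar x,M\models_s\phi\}$ for every first-order $\phi$ with element parameters $\bar m$ and relation parameters $R_i=\mathrm{Rel}(X_i)=\{s(\bar z):s\in X_i\}$, $X_i\in\mathcal G$. The intersection of any family of general models over $M$ is a general model. The least general model over $M$ is $(M,\mathcal L)$ with $\mathcal L=\bigcap\{\mathcal G:(M,\mathcal G)\text{ is a general model}\}$. Satisfaction $(M,\mathcal G)\models_X\phi$ for independence logic formulas (negation normal form, with atoms $\bar t_2\perp_{\bar t_1}\bar t_3$) is the usual lax team semantics, except that: - disjunction splits $X$ only into teams in $\mathcal G$; - $\exists x$ only uses $x$-variations of $X$ in $\mathcal G$. -}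

module Defs where

open import Level using (Level; _⊔_; Lift; 0ℓ) renaming (suc to lsuc)
open import Data.Nat using (ℕ; _≟_)
open import Data.List using (List; []; _∷_; map)
open import Data.List.Membership.Propositional using (_∈_)
open import Data.List.Relation.Unary.Any using (here; there)
open import Data.List.Relation.Unary.All using (All)
open import Data.List.Relation.Unary.Unique.Propositional using (Unique)
open import Data.Vec using (Vec; []; _∷_)
open import Data.Product using (Σ; ∃; _×_; _,_)
open import Data.Sum using (_⊎_)
open import Data.Empty using (⊥; ⊥-elim)
open import Data.Unit using (⊤)
open import Function using (id)
open import Relation.Nullary using (¬_; yes; no)
open import Relation.Binary.PropositionalEquality using (_≡_; refl)

Var : Set
Var = ℕ

_⇔_ : ∀ {a b} → Set a → Set b → Set (a ⊔ b)
P ⇔ Q = (P → Q) × (Q → P)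

record Signature : Set₁ where
  field
    Fun      : Set
    funArity : Fun → ℕ
    Rel      : Set
    relArity : Rel → ℕ

record Structure (S : Signature) : Set₁ where
  open Signature S
  field
    Carrier    : Set
    inhabitant : Carrier
    funI       : (f : Fun) → Vec Carrier (funArity f) → Carrier
    relI       : (R : Rel) → Vec Carrier (relArity R) → Set

-- Terms over S, with constants (element parameters) from C.
data Term (S : Signature) (C : Set) : Set where
  var : Var → Term S C
  cst : C → Term S C
  app : (f : Signature.Fun S) → Vec (Term S C) (Signature.funArity S f) → Term S C

mutual
  TVarsIn : ∀ {S C} → List Var → Term S C → Set
  TVarsIn D (var x) = x ∈ D
  TVarsIn D (cst _) = ⊤
  TVarsIn D (app f ts) = VVarsIn D ts

  VVarsIn : ∀ {S C n} → List Var → Vec (Term S C) n → Set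
  VVarsIn D [] = ⊤
  VVarsIn D (t ∷ ts) = TVarsIn D t × VVarsIn D ts

module Semantics (S : Signature) (M : Structure S) where
  open Signature S
  open Structure M renaming (Carrier to A)

  -- Assignments are total (M is nonempty); a team with domain D is
  -- represented by a set of total assignments that only depends on D.
  Assignment : Set
  Assignment = Var → A

  _[_↦_] : Assignment → Var → A → Assignment
  (s [ x ↦ a ]) y with y ≟ x
  ... | yes _ = a
  ... | no _ = s y

  mutual
    eval : {C : Set} → (C → A) → Assignment → Term S C → A
    eval c s (var x) = s x
    eval c s (cst k) = c k
    eval c s (app f ts) = funI f (evalVec c s ts)

    evalVec : ∀ {C n} → (C → A) → Assignment → Vec (Term S C) n → Vec A n
    evalVec c s [] = []
    evalVec c s (t ∷ ts) = eval c s t ∷ evalVec c s ts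

  AgreeOn : List Var → Assignment → Assignment → Set
  AgreeOn D s s' = ∀ x → x ∈ D → s x ≡ s' x

  record Team : Set₁ where
    field
      dom   : List Var
      mem   : Assignment → Set
      local : ∀ {s s'} → AgreeOn dom s s' → mem s → mem s'
  open Team public

  SameVars : List Var → List Var → Set
  SameVars D E = ∀ x → (x ∈ D) ⇔ (x ∈ E)

  -- equality of teams (a set of teams is a predicate respecting this)
  _≈ₜ_ : Team → Team → Set
  X ≈ₜ Y = SameVars (dom X) (dom Y) × (∀ s → mem X s ⇔ mem Y s)

  Enumerates : List Var → Team → Set
  Enumerates zs X = Unique zs × SameVars zs (dom X)

  RelOf : Team → List Var → List A → Set
  RelOf X zs as = ∃ λ s → mem X s × map s zs ≡ as

  -- First-order formulas with element parameters and team-relation parameters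
  FTerm : Set
  FTerm = Term S A

  data FO : Set₁ where
    rel  : (R : Rel) → Vec FTerm (relArity R) → FO
    eq   : FTerm → FTerm → FO
    prm  : (X : Team) (zs : List Var) → List FTerm → FO   -- Rel(X)(t̄), z̄ enumerating Dom(X)
    neg  : FO → FO
    and  : FO → FO → FO
    or   : FO → FO → FO
    ex   : Var → FO → FO
    all  : Var → FO → FO

  _⊨FO_ : Assignment → FO → Set
  s ⊨FO rel R ts = relI R (evalVec id s ts)
  s ⊨FO eq t u = eval id s t ≡ eval id s u
  s ⊨FO prm X zs ts = RelOf X zs (map (eval id s) ts)
  s ⊨FO neg φ = ¬ (s ⊨FO φ)
  s ⊨FO and φ ψ = (s ⊨FO φ) × (s ⊨FO ψ)
  s ⊨FO or φ ψ = (s ⊨FO φ) ⊎ (s ⊨FO ψ)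
  s ⊨FO ex x φ = ∃ λ a → (s [ x ↦ a ]) ⊨FO φ
  s ⊨FO all x φ = ∀ a → (s [ x ↦ a ]) ⊨FO φ

  FOVarsIn : List Var → FO → Set
  FOVarsIn D (rel R ts) = VVarsIn D ts
  FOVarsIn D (eq t u) = TVarsIn D t × TVarsIn D u
  FOVarsIn D (prm X zs ts) = All (TVarsIn D) ts
  FOVarsIn D (neg φ) = FOVarsIn D φ
  FOVarsIn D (and φ ψ) = FOVarsIn D φ × FOVarsIn D ψ
  FOVarsIn D (or φ ψ) = FOVarsIn D φ × FOVarsIn D ψ
  FOVarsIn D (ex x φ) = FOVarsIn (x ∷ D) φ
  FOVarsIn D (all x φ) = FOVarsIn (x ∷ D) φ

  ParamsIn : ∀ {ℓ} → (Team → Set ℓ) → FO → Set (lsuc 0ℓ ⊔ ℓ)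
  ParamsIn {ℓ} 𝒢 (rel R ts) = Lift (lsuc 0ℓ ⊔ ℓ) ⊤
  ParamsIn {ℓ} 𝒢 (eq t u) = Lift (lsuc 0ℓ ⊔ ℓ) ⊤
  ParamsIn {ℓ} 𝒢 (prm X zs ts) = Lift (lsuc 0ℓ ⊔ ℓ) (𝒢 X × Enumerates zs X)
  ParamsIn 𝒢 (neg φ) = ParamsIn 𝒢 φ
  ParamsIn 𝒢 (and φ ψ) = ParamsIn 𝒢 φ × ParamsIn 𝒢 ψ
  ParamsIn 𝒢 (or φ ψ) = ParamsIn 𝒢 φ × ParamsIn 𝒢 ψ
  ParamsIn 𝒢 (ex x φ) = ParamsIn 𝒢 φ
  ParamsIn 𝒢 (all x φ) = ParamsIn 𝒢 φ

  record IsGeneralModel {ℓ} (𝒢 : Team → Set ℓ) : Set (lsuc 0ℓ ⊔ ℓ) where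
    field
      respects   : ∀ {X Y} → X ≈ₜ Y → 𝒢 X → 𝒢 Y
      -- ‖φ(x̄, m̄, R̄)‖_M ∈ 𝒢  (for the team X equal to it, with Dom(X) = D = x̄)
      definable  : (D : List Var) (φ : FO) → FOVarsIn D φ → ParamsIn 𝒢 φ →
                   (X : Team) → SameVars (dom X) D →
                   (∀ s → mem X s ⇔ (s ⊨FO φ)) → 𝒢 X

  𝓛 : Team → Set₂
  𝓛 X = (𝒢 : Team → Set₁) → IsGeneralModel 𝒢 → 𝒢 X

  -- Independence logic in negation normal form, signature S (no parameters)
  ITerm : Set
  ITerm = Term S ⊥

  data IL : Set where
    rel   : (R : Rel) → Vec ITerm (relArity R) → IL
    nrel  : (R : Rel) → Vec ITerm (relArity R) → IL
    eq    : ITerm → ITerm → IL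
    neq   : ITerm → ITerm → IL
    indep : (t₁ t₂ t₃ : List ITerm) → IL   -- t₂ ⊥_{t₁} t₃
    and   : IL → IL → IL
    or    : IL → IL → IL
    ex    : Var → IL → IL
    all   : Var → IL → IL

  ILVarsIn : List Var → IL → Set
  ILVarsIn D (rel R ts) = VVarsIn D ts
  ILVarsIn D (nrel R ts) = VVarsIn D ts
  ILVarsIn D (eq t u) = TVarsIn D t × TVarsIn D u
  ILVarsIn D (neq t u) = TVarsIn D t × TVarsIn D u
  ILVarsIn D (indep t₁ t₂ t₃) = All (TVarsIn D) t₁ × All (TVarsIn D) t₂ × All (TVarsIn D) t₃
  ILVarsIn D (and φ ψ) = ILVarsIn D φ × ILVarsIn D ψ
  ILVarsIn D (or φ ψ) = ILVarsIn D φ × ILVarsIn D ψ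
  ILVarsIn D (ex x φ) = ILVarsIn (x ∷ D) φ
  ILVarsIn D (all x φ) = ILVarsIn (x ∷ D) φ

  ev : Assignment → ITerm → A
  ev = eval ⊥-elim

  evs : Assignment → List ITerm → List A
  evs s = map (ev s)

  Flat : Team → (Assignment → Set) → Set
  Flat X P = ∀ s → mem X s → P s

  IndepHolds : Team → List ITerm → List ITerm → List ITerm → Set
  IndepHolds X t₁ t₂ t₃ =
    ∀ s s' → mem X s → mem X s' → evs s t₁ ≡ evs s' t₁ →
    ∃ λ s'' → mem X s'' × evs s'' t₁ ≡ evs s t₁ × evs s'' t₂ ≡ evs s t₂
              × evs s'' t₃ ≡ evs s' t₃

  SplitsInto : Team → Team → Team → Set
  SplitsInto X Y Z = SameVars (dom Y) (dom X) × SameVars (dom Z) (dom X)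
                     × (∀ s → mem X s ⇔ (mem Y s ⊎ mem Z s))

  -- Y is an x-variation of X (lax: Y = X[H/x] with H(s) ≠ ∅)
  IsVariation : Var → Team → Team → Set
  IsVariation x X Y = SameVars (dom Y) (x ∷ dom X)
                      × (∀ s → mem X s → ∃ λ a → mem Y (s [ x ↦ a ]))
                      × (∀ s → mem Y s → ∃ λ a → mem X (s [ x ↦ a ]))

  upd-agree : ∀ {D x a s s'} → AgreeOn (x ∷ D) s s' → AgreeOn D (s [ x ↦ a ]) (s' [ x ↦ a ])
  upd-agree {x = x} agr y p with y ≟ x
  ... | yes _ = refl
  ... | no _ = agr y (there p)

  duplicate : Var → Team → Team
  duplicate x X = record
    { dom = x ∷ dom X
    ; mem = λ s → ∃ λ a → mem X (s [ x ↦ a ])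
    ; local = λ { agr (a , m) → a , local X (upd-agree agr) m }
    }

  Sat : ∀ {ℓ} → (Team → Set ℓ) → Team → IL → Set (lsuc 0ℓ ⊔ ℓ)
  Sat {ℓ} 𝒢 X (rel R ts) = Lift (lsuc 0ℓ ⊔ ℓ) (Flat X λ s → relI R (evalVec ⊥-elim s ts))
  Sat {ℓ} 𝒢 X (nrel R ts) = Lift (lsuc 0ℓ ⊔ ℓ) (Flat X λ s → ¬ relI R (evalVec ⊥-elim s ts))
  Sat {ℓ} 𝒢 X (eq t u) = Lift (lsuc 0ℓ ⊔ ℓ) (Flat X λ s → ev s t ≡ ev s u)
  Sat {ℓ} 𝒢 X (neq t u) = Lift (lsuc 0ℓ ⊔ ℓ) (Flat X λ s → ¬ ev s t ≡ ev s u)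
  Sat {ℓ} 𝒢 X (indep t₁ t₂ t₃) = Lift (lsuc 0ℓ ⊔ ℓ) (IndepHolds X t₁ t₂ t₃)
  Sat 𝒢 X (and φ ψ) = Sat 𝒢 X φ × Sat 𝒢 X ψ
  Sat 𝒢 X (or φ ψ) = Σ Team λ Y → Σ Team λ Z →
    𝒢 Y × 𝒢 Z × SplitsInto X Y Z × Sat 𝒢 Y φ × Sat 𝒢 Z ψ
  Sat 𝒢 X (ex x φ) = Σ Team λ Y → 𝒢 Y × IsVariation x X Y × Sat 𝒢 Y φ
  Sat 𝒢 X (all x φ) = Sat 𝒢 (duplicate x X) φ

module Submission where

-- Proof idea.  Satisfaction (M, 𝒢) ⊨_X φ only consults 𝒢 through the
-- teams that disjunction splits into and that ∃ moves to, always
-- positively; hence it is monotone in 𝒢 (Sat-mono).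
--
-- (⇒) 𝓛 is contained in every general model 𝒢, so monotonicity turns
--     (M, 𝓛) ⊨_X φ into (M, 𝒢) ⊨_X φ.
-- (⇐) We cannot instantiate the hypothesis with 𝓛 itself: 𝓛 quantifies
--     over all families Team → Set₁, so it lives in Set₂.  Instead we build
--     the least general model inductively, as the closure `Least` of the two
--     general-model rules; it is a family in Set₁ and a general model, and
--     by induction it is contained in every general model, hence in 𝓛.
--     Instantiating the hypothesis with `Least` and applying monotonicity
--     along Least ⊆ 𝓛 gives (M, 𝓛) ⊨_X φ.

open import Defs
open import Level using (0ℓ; _⊔_; lift) renaming (suc to lsuc)
open import Data.Product using (_,_)
open import Data.List using (List)

module LeastGeneralModel (S : Signature) (M : Structure S) where
  open Semantics S M

  _⊆_ : ∀ {ℓ ℓ'} → (Team → Set ℓ) → (Team → Set ℓ') → Set (lsuc 0ℓ ⊔ ℓ ⊔ ℓ')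
  𝒢 ⊆ 𝒢' = ∀ X → 𝒢 X → 𝒢' X

  -- Satisfaction is monotone in the family of admissible teams: a larger
  -- family offers more splits and more variations, and nothing else changes.
  Sat-mono : ∀ {ℓ ℓ'} {𝒢 : Team → Set ℓ} {𝒢' : Team → Set ℓ'} →
             𝒢 ⊆ 𝒢' → ∀ X φ → Sat 𝒢 X φ → Sat 𝒢' X φ
  Sat-mono 𝒢⊆𝒢' X (rel R ts) (lift p) = lift p
  Sat-mono 𝒢⊆𝒢' X (nrel R ts) (lift p) = lift p
  Sat-mono 𝒢⊆𝒢' X (eq t u) (lift p) = lift p
  Sat-mono 𝒢⊆𝒢' X (neq t u) (lift p) = lift p
  Sat-mono 𝒢⊆𝒢' X (indep t₁ t₂ t₃) (lift p) = lift p
  Sat-mono 𝒢⊆𝒢' X (and φ ψ) (X⊨φ , X⊨ψ) =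
    Sat-mono 𝒢⊆𝒢' X φ X⊨φ , Sat-mono 𝒢⊆𝒢' X ψ X⊨ψ
  Sat-mono 𝒢⊆𝒢' X (or φ ψ) (Y , Z , 𝒢Y , 𝒢Z , split , Y⊨φ , Z⊨ψ) =
    Y , Z , 𝒢⊆𝒢' Y 𝒢Y , 𝒢⊆𝒢' Z 𝒢Z , split ,
    Sat-mono 𝒢⊆𝒢' Y φ Y⊨φ , Sat-mono 𝒢⊆𝒢' Z ψ Z⊨ψ
  Sat-mono 𝒢⊆𝒢' X (ex x φ) (Y , 𝒢Y , variation , Y⊨φ) =
    Y , 𝒢⊆𝒢' Y 𝒢Y , variation , Sat-mono 𝒢⊆𝒢' Y φ Y⊨φ
  Sat-mono 𝒢⊆𝒢' X (all x φ) X⊨φ = Sat-mono 𝒢⊆𝒢' (duplicate x X) φ X⊨φ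

  𝓛⊆ : (𝒢 : Team → Set₁) → IsGeneralModel 𝒢 → 𝓛 ⊆ 𝒢
  𝓛⊆ 𝒢 isGM X 𝓛X = 𝓛X 𝒢 isGM

  data Least : Team → Set₁ where
    respects  : ∀ {X Y} → X ≈ₜ Y → Least X → Least Y
    definable : (D : List Var) (φ : FO) → FOVarsIn D φ → ParamsIn Least φ →
                (X : Team) → SameVars (dom X) D →
                (∀ s → mem X s ⇔ (s ⊨FO φ)) → Least X

  Least-isGeneralModel : IsGeneralModel Least
  Least-isGeneralModel = record { respects = respects ; definable = definable }

  module _ {𝒢 : Team → Set₁} (isGM : IsGeneralModel 𝒢) where
    module 𝒢 = IsGeneralModel isGM

    mutual
      Least⊆ : Least ⊆ 𝒢
      Least⊆ Y (respects X≈Y LX) = 𝒢.respects X≈Y (Least⊆ _ LX)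
      Least⊆ X (definable D φ vars params .X sameVars ext) =
        𝒢.definable D φ vars (params⊆ φ params) X sameVars ext

      params⊆ : ∀ φ → ParamsIn Least φ → ParamsIn 𝒢 φ
      params⊆ (rel R ts) _ = lift _
      params⊆ (eq t u) _ = lift _
      params⊆ (prm X zs ts) (lift (LX , enum)) = lift (Least⊆ X LX , enum)
      params⊆ (neg φ) p = params⊆ φ p
      params⊆ (and φ ψ) (p , q) = params⊆ φ p , params⊆ ψ q
      params⊆ (or φ ψ) (p , q) = params⊆ φ p , params⊆ ψ q
      params⊆ (ex x φ) p = params⊆ φ p
      params⊆ (all x φ) p = params⊆ φ p

  Least⊆𝓛 : Least ⊆ 𝓛
  Least⊆𝓛 X LX 𝒢 isGM = Least⊆ isGM X LX

mainTheorem12 : (S : Signature) (M : Structure S) → let open Semantics S M in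
    (X : Team) → 𝓛 X → (φ : IL) → ILVarsIn (dom X) φ →
    Sat 𝓛 X φ ⇔ ((𝒢 : Team → Set₁) → IsGeneralModel 𝒢 → Sat 𝒢 X φ)
mainTheorem12 S M X _ φ _ = 𝓛⇒all , all⇒𝓛
  where
    open Semantics S M
    open LeastGeneralModel S M

    𝓛⇒all : Sat 𝓛 X φ → (𝒢 : Team → Set₁) → IsGeneralModel 𝒢 → Sat 𝒢 X φ
    𝓛⇒all X⊨φ 𝒢 isGM = Sat-mono (𝓛⊆ 𝒢 isGM) X φ X⊨φ

    all⇒𝓛 : ((𝒢 : Team → Set₁) → IsGeneralModel 𝒢 → Sat 𝒢 X φ) → Sat 𝓛 X φ
    all⇒𝓛 X⊨φ = Sat-mono Least⊆𝓛 X φ (X⊨φ Least Least-isGeneralModel)
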